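{- Let $\mathcal{G}$ be a simple undirected temporal graph with strict reachability and let $S$ be an inclusion-minimal nontrivial closed tcc of $\mathcal{G}$. Then the underlying graph $G[S]$ is $2$-vertex-connected.
   Context: An undirected temporal graph is $\mathcal{G}=(G,\lambda)$ with $G=(V,E)$ a finite undirected graph and $\lambda$ assigning each edge a nonempty set of positive integer labels; it is simple if each edge has exactly one label. Under strict reachability, a temporal path is a path of $G$ whose labels are strictly increasing along the path. For $S\subseteq V$, $\mathcal{G}[S]$ is the temporal graph on the induced subgraph $G[S]$ with labels restricted; $S$ is a closed tcc if $\mathcal{G}[S]$ is temporally connected (every ordered pair of distinct vertices of $S$ joined by a strict temporal path inside $\mathcal{G}[S]$); it is nontrivial if $|S|\ge 3$. Inclusion-minimal nontrivial closed tcc: a nontrivial closed tcc $S$ such that no proper subset of $S$ is a nontrivial closed tcc. -}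

module Defs where

open import Data.Nat using (ℕ; _<_; _≤_)
open import Data.Fin using (Fin)
open import Data.Fin.Subset using (Subset; _∈_; _⊂_; ∣_∣; _-_)
open import Data.Maybe using (Maybe; just; nothing)
open import Data.List using (List; []; _∷_)
open import Data.List.Relation.Unary.Unique.Propositional using (Unique)
open import Data.Product using (Σ; ∃; _×_)
open import Relation.Binary.PropositionalEquality using (_≡_; _≢_)
open import Relation.Nullary using (¬_)

-- A simple undirected temporal graph on the finite vertex set Fin n.
-- label u v = just t  means {u,v} is an edge with (unique) label t;
-- label u v = nothing means {u,v} is not an edge.
record SimpleTemporalGraph (n : ℕ) : Set where
  field
    label     : Fin n → Fin n → Maybe ℕ
    label-sym : ∀ u v → label u v ≡ label v u
    no-loops  : ∀ u → label u u ≡ nothing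
    label-pos : ∀ u v t → label u v ≡ just t → 0 < t
open SimpleTemporalGraph public

module _ {n : ℕ} (𝒢 : SimpleTemporalGraph n) (S : Subset n) where

  -- Strict temporal walk inside 𝒢[S] from u to v, all of whose labels are > t.
  data TWalk : Fin n → Fin n → ℕ → Set where
    done : ∀ {u t} → u ∈ S → TWalk u u t
    step : ∀ {u w v t t′} → u ∈ S → label 𝒢 u w ≡ just t′ → t < t′ →
           TWalk w v t′ → TWalk u v t

  twalkVerts : ∀ {u v t} → TWalk u v t → List (Fin n)
  twalkVerts (done {u} _) = u ∷ []
  twalkVerts (step {u} _ _ _ w) = u ∷ twalkVerts w

  TPath : Fin n → Fin n → Set
  TPath u v = Σ (TWalk u v 0) (λ w → Unique (twalkVerts w))

  ClosedTCC : Set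
  ClosedTCC = ∀ u v → u ∈ S → v ∈ S → u ≢ v → TPath u v

  NontrivialClosedTCC : Set
  NontrivialClosedTCC = 3 ≤ ∣ S ∣ × ClosedTCC

  data SWalk : Fin n → Fin n → Set where
    done : ∀ {u} → u ∈ S → SWalk u u
    step : ∀ {u w v} → u ∈ S → (∃ λ t → label 𝒢 u w ≡ just t) →
           SWalk w v → SWalk u v

  Connected : Set
  Connected = ∀ u v → u ∈ S → v ∈ S → SWalk u v

MinimalNontrivialClosedTCC : ∀ {n} → SimpleTemporalGraph n → Subset n → Set
MinimalNontrivialClosedTCC 𝒢 S =
  NontrivialClosedTCC 𝒢 S × (∀ S′ → S′ ⊂ S → ¬ NontrivialClosedTCC 𝒢 S′)

TwoVertexConnected : ∀ {n} → SimpleTemporalGraph n → Subset n → Set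
TwoVertexConnected 𝒢 S =
  3 ≤ ∣ S ∣ × Connected 𝒢 S × (∀ x → x ∈ S → Connected 𝒢 (S - x))

-- Fix x ∈ S and u, v ∈ S − x. Let R be the component of u in G[S − x]. Every temporal
-- path of G[S] between two vertices of R ∪ {x} stays inside R ∪ {x}: it can only leave
-- through x, and then it could only come back through x again. So R ∪ {x} is a closed
-- tcc, and if v ∉ R it is a proper subset of S; by minimality it is then trivial, i.e.
-- R = {u} and x is the only neighbour of u in G[S]. If v and u could not reach each
-- other in G[S − x], x would be the only neighbour of both, and the temporal paths
-- u x v and v x u would need λ(ux) < λ(xv) = λ(vx) < λ(xu) = λ(ux).
module Submission where

open import Defs
open import Data.Nat using (ℕ; _<_; _≤_)
open import Data.Nat.Properties using (<-trans; <-asym; ≤-<-trans)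
open import Data.Fin using (Fin; _≟_) renaming (zero to fzero; suc to fsuc)
open import Data.Fin.Properties using (any?)
open import Data.Fin.Subset using (Subset; _∈_; _∉_; _⊆_; _⊂_; _⊃_; ∣_∣; _─_; _-_; _∪_; ⁅_⁆; inside; outside)
open import Data.Fin.Subset.Properties using (_∈?_; p⊆p∪q; x∈p∪q⁺; x∈p∪q⁻; x∈⁅x⁆; x∈⁅y⁆⇒x≡y; ∣⁅x⁆∣≡1; p─q⊆p; x∈p∧x≢y⇒x∈p-y; p⊂q⇒∣p∣<∣q∣)
open import Data.Fin.Subset.Induction using (Acc; acc; ⊃-wellFounded)
open import Data.Vec using (_∷_; there)
open import Data.Maybe using (just; nothing)
open import Data.Maybe.Properties using (just-injective)
open import Data.List using (_∷_)
open import Data.List.Membership.Propositional using () renaming (_∈_ to _∈ₗ_)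
open import Data.List.Relation.Unary.Any using (here; there)
open import Data.List.Relation.Unary.All as All using ()
open import Data.List.Relation.Unary.AllPairs using (_∷_)
open import Data.List.Relation.Unary.Unique.Propositional using (Unique)
open import Data.Product using (Σ; ∃; ∃₂; _×_; _,_; proj₁; proj₂)
open import Data.Sum using (_⊎_; inj₁; inj₂)
open import Data.Empty using (⊥; ⊥-elim)
open import Relation.Binary.PropositionalEquality using (_≡_; _≢_; refl; sym; trans; cong; subst; ≢-sym)
open import Relation.Nullary using (¬_; Dec; yes; no)
open import Relation.Nullary.Decidable using (_×-dec_; ¬?; decidable-stable)

x∈p─q⇒x∉q : ∀ {n} (p q : Subset n) {x : Fin n} → x ∈ p ─ q → x ∉ q
x∈p─q⇒x∉q (_ ∷ p) (inside  ∷ q) {fzero}  ()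
x∈p─q⇒x∉q (_ ∷ p) (outside ∷ q) {fzero}  _          ()
x∈p─q⇒x∉q (_ ∷ p) (_       ∷ q) {fsuc x} (there m) (there m′) = x∈p─q⇒x∉q p q m m′

module _ {n : ℕ} where

  x∈p-y⇒x∈p : {p : Subset n} {x y : Fin n} → x ∈ p - y → x ∈ p
  x∈p-y⇒x∈p {p} {y = y} = p─q⊆p p ⁅ y ⁆

  x∈p-y⇒x≢y : {p : Subset n} {x y : Fin n} → x ∈ p - y → x ≢ y
  x∈p-y⇒x≢y {p} {y = y} m refl = x∈p─q⇒x∉q p ⁅ y ⁆ m (x∈⁅x⁆ y)

  x∉p⇒p⊂p∪⁅x⁆ : {p : Subset n} {x : Fin n} → x ∉ p → p ⊂ p ∪ ⁅ x ⁆
  x∉p⇒p⊂p∪⁅x⁆ {x = x} x∉p = p⊆p∪q ⁅ x ⁆ , x , x∈p∪q⁺ (inj₂ (x∈⁅x⁆ x)) , x∉p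

  x∈p∧y∈p∧x≢y⇒2≤∣p∣ : {p : Subset n} {x y : Fin n} → x ∈ p → y ∈ p → x ≢ y → 2 ≤ ∣ p ∣
  x∈p∧y∈p∧x≢y⇒2≤∣p∣ {p} {x} {y} x∈p y∈p x≢y =
    subst (_< ∣ p ∣) (∣⁅x⁆∣≡1 x)
      (p⊂q⇒∣p∣<∣q∣ (⁅x⁆⊆p , y , y∈p , λ y∈⁅x⁆ → x≢y (sym (x∈⁅y⁆⇒x≡y x y∈⁅x⁆))))
    where
    ⁅x⁆⊆p : ⁅ x ⁆ ⊆ p
    ⁅x⁆⊆p z∈⁅x⁆ rewrite x∈⁅y⁆⇒x≡y x z∈⁅x⁆ = x∈p

module _ {n : ℕ} (𝒢 : SimpleTemporalGraph n) where

  Adjacent : Fin n → Fin n → Set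
  Adjacent u v = ∃ λ t → label 𝒢 u v ≡ just t

  adjacent-sym : ∀ {u v} → Adjacent u v → Adjacent v u
  adjacent-sym {u} {v} (t , e) = t , trans (label-sym 𝒢 v u) e

  adjacent-irrefl : ∀ {u} → ¬ Adjacent u u
  adjacent-irrefl {u} (t , e) with trans (sym (no-loops 𝒢 u)) e
  ... | ()

  adjacent? : ∀ u v → Dec (Adjacent u v)
  adjacent? u v with label 𝒢 u v
  ... | just t  = yes (t , refl)
  ... | nothing = no λ { (_ , ()) }

  TWalk-source∈ : ∀ {S u v t} → TWalk 𝒢 S u v t → u ∈ S
  TWalk-source∈ (done u∈S)       = u∈S
  TWalk-source∈ (step u∈S _ _ _) = u∈S

  TWalk-source∈Verts : ∀ {S u v t} (W : TWalk 𝒢 S u v t) → u ∈ₗ twalkVerts 𝒢 S W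
  TWalk-source∈Verts (done _)       = here refl
  TWalk-source∈Verts (step _ _ _ _) = here refl

  TWalk⇒SWalk : ∀ {S u v t} → TWalk 𝒢 S u v t → SWalk 𝒢 S u v
  TWalk⇒SWalk (done u∈S)       = done u∈S
  TWalk⇒SWalk (step u∈S e _ W) = step u∈S (_ , e) (TWalk⇒SWalk W)

  SWalk-target∈ : ∀ {S u v} → SWalk 𝒢 S u v → v ∈ S
  SWalk-target∈ (done v∈S)   = v∈S
  SWalk-target∈ (step _ _ W) = SWalk-target∈ W

  SWalk-snoc : ∀ {S u v w} → SWalk 𝒢 S u v → Adjacent v w → w ∈ S → SWalk 𝒢 S u w
  SWalk-snoc (done v∈S)       vw w∈S = step v∈S vw (done w∈S)
  SWalk-snoc (step u∈S uu′ W) vw w∈S = step u∈S uu′ (SWalk-snoc W vw w∈S)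

  SWalk-reverse : ∀ {S u v} → SWalk 𝒢 S u v → SWalk 𝒢 S v u
  SWalk-reverse (done u∈S)       = done u∈S
  SWalk-reverse (step u∈S uu′ W) = SWalk-snoc (SWalk-reverse W) (adjacent-sym uu′) u∈S

  ClosedTCC⇒Connected : ∀ {S} → ClosedTCC 𝒢 S → Connected 𝒢 S
  ClosedTCC⇒Connected tcc u v u∈S v∈S with u ≟ v
  ... | yes refl = done u∈S
  ... | no u≢v   = TWalk⇒SWalk (proj₁ (tcc u v u∈S v∈S u≢v))

  AdjacencyClosed : Subset n → Subset n → Set
  AdjacencyClosed P R = ∀ {w w′} → w ∈ R → w′ ∈ P → Adjacent w w′ → w′ ∈ R

  record Component (P : Subset n) (u : Fin n) : Set where
    field
      members   : Subset n
      source∈   : u ∈ members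
      reachable : ∀ {w} → w ∈ members → SWalk 𝒢 P u w
      closed    : AdjacencyClosed P members

  module _ {P : Subset n} {u : Fin n} where

    private
      Exit : Subset n → Set
      Exit R = ∃₂ λ w w′ → w ∈ R × w′ ∈ P × Adjacent w w′ × w′ ∉ R

      exit? : ∀ R → Dec (Exit R)
      exit? R = any? λ w → any? λ w′ →
        w ∈? R ×-dec w′ ∈? P ×-dec adjacent? w w′ ×-dec ¬? (w′ ∈? R)

    grow : (R : Subset n) → Acc _⊃_ R → u ∈ R → (∀ {w} → w ∈ R → SWalk 𝒢 P u w) → Component P u
    grow R (acc rs) u∈R reach with exit? R
    ... | no ¬exit = record
      { members = R ; source∈ = u∈R ; reachable = reach
      ; closed = λ {w} {w′} w∈R w′∈P ww′ →
          decidable-stable (w′ ∈? R) λ w′∉R → ¬exit (w , w′ , w∈R , w′∈P , ww′ , w′∉R) }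
    ... | yes (w , w′ , w∈R , w′∈P , ww′ , w′∉R) =
      grow (R ∪ ⁅ w′ ⁆) (rs (x∉p⇒p⊂p∪⁅x⁆ w′∉R)) (p⊆p∪q ⁅ w′ ⁆ u∈R) reach′
      where
      reach′ : ∀ {z} → z ∈ R ∪ ⁅ w′ ⁆ → SWalk 𝒢 P u z
      reach′ z∈ with x∈p∪q⁻ R ⁅ w′ ⁆ z∈
      ... | inj₁ z∈R    = reach z∈R
      ... | inj₂ z∈⁅w′⁆ rewrite x∈⁅y⁆⇒x≡y w′ z∈⁅w′⁆ = SWalk-snoc (reach w∈R) ww′ w′∈P

    component : u ∈ P → Component P u
    component u∈P = grow ⁅ u ⁆ (⊃-wellFounded ⁅ u ⁆) (x∈⁅x⁆ u) reach
      where
      reach : ∀ {w} → w ∈ ⁅ u ⁆ → SWalk 𝒢 P u w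
      reach w∈⁅u⁆ rewrite x∈⁅y⁆⇒x≡y u w∈⁅u⁆ = done u∈P

  ExitsOnlyThrough : Subset n → Subset n → Fin n → Set
  ExitsOnlyThrough S T x = ∀ {w w′} → w ∈ T → w′ ∈ S → w′ ∉ T → Adjacent w w′ → w ≡ x

  module _ {S T : Subset n} {x : Fin n} (exits : ExitsOnlyThrough S T x) where

    TWalk-enters-through : ∀ {w v t} (W : TWalk 𝒢 S w v t) → w ∉ T → v ∈ T → x ∈ₗ twalkVerts 𝒢 S W
    TWalk-enters-through (done _) w∉T v∈T = ⊥-elim (w∉T v∈T)
    TWalk-enters-through (step {w = w₁} w∈S e _ W) w∉T v∈T with w₁ ∈? T
    ... | no w₁∉T = there (TWalk-enters-through W w₁∉T v∈T)
    ... | yes w₁∈T with exits w₁∈T w∈S w∉T (adjacent-sym (_ , e))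
    ...   | refl = there (TWalk-source∈Verts W)

    TWalk-restrict : ∀ {u v t} (W : TWalk 𝒢 S u v t) → Unique (twalkVerts 𝒢 S W) → u ∈ T → v ∈ T →
                     Σ (TWalk 𝒢 T u v t) λ W′ → twalkVerts 𝒢 T W′ ≡ twalkVerts 𝒢 S W
    TWalk-restrict (done _) _ u∈T _ = done u∈T , refl
    TWalk-restrict {u} (step {w = w₁} _ e lt W) (u∉W ∷ unique) u∈T v∈T with w₁ ∈? T
    ... | yes w₁∈T = let W′ , same = TWalk-restrict W unique w₁∈T v∈T in
                     step u∈T e lt W′ , cong (u ∷_) same
    ... | no w₁∉T with exits u∈T (TWalk-source∈ W) w₁∉T (_ , e)
    ...   | refl = ⊥-elim (All.lookup u∉W (TWalk-enters-through W w₁∉T v∈T) refl)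

    ClosedTCC-restrict : T ⊆ S → ClosedTCC 𝒢 S → ClosedTCC 𝒢 T
    ClosedTCC-restrict T⊆S tcc u v u∈T v∈T u≢v =
      let W , unique = tcc u v (T⊆S u∈T) (T⊆S v∈T) u≢v
          W′ , same  = TWalk-restrict W unique u∈T v∈T
      in W′ , subst Unique (sym same) unique

  AdjacencyClosed-∪⁅⁆-exits : ∀ {S R x} → AdjacencyClosed (S - x) R → ExitsOnlyThrough S (R ∪ ⁅ x ⁆) x
  AdjacencyClosed-∪⁅⁆-exits {S} {R} {x} closed w∈T w′∈S w′∉T ww′ with x∈p∪q⁻ R ⁅ x ⁆ w∈T
  ... | inj₂ w∈⁅x⁆ = x∈⁅y⁆⇒x≡y x w∈⁅x⁆
  ... | inj₁ w∈R   = ⊥-elim (w′∉T (x∈p∪q⁺ (inj₁ (closed w∈R (x∈p∧x≢y⇒x∈p-y w′∈S w′≢x) ww′))))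
    where
    w′≢x : _ ≢ x
    w′≢x refl = w′∉T (x∈p∪q⁺ (inj₂ (x∈⁅x⁆ x)))

  OnlyNeighbour : Subset n → Fin n → Fin n → Set
  OnlyNeighbour S x u = ∀ {z} → z ∈ S → Adjacent u z → z ≡ x

  module _ {S : Subset n} {x : Fin n} where

    TWalk-arrives-from : ∀ {u v t} → OnlyNeighbour S x v → TWalk 𝒢 S u v t → u ≢ v →
                         ∃ λ s → label 𝒢 x v ≡ just s × t < s
    TWalk-arrives-from only (done _) u≢v = ⊥-elim (u≢v refl)
    TWalk-arrives-from {v = v} only (step {w = w₁} {t′ = t′} u∈S e lt W) _ with w₁ ≟ v
    ... | no w₁≢v  = let s , e′ , lt′ = TWalk-arrives-from only W w₁≢v in s , e′ , <-trans lt lt′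
    ... | yes refl with only u∈S (adjacent-sym (_ , e))
    ...   | refl = t′ , e , lt

    -- the walk must be u x … x v, so λ(ux) < λ(xv)
    TWalk-between-leaves : ∀ {u v t} → OnlyNeighbour S x u → OnlyNeighbour S x v →
                           TWalk 𝒢 S u v t → u ≢ v → v ≢ x →
                           ∃₂ λ a b → label 𝒢 x u ≡ just a × label 𝒢 x v ≡ just b × a < b
    TWalk-between-leaves onlyᵤ onlyᵥ (done _) u≢v v≢x = ⊥-elim (u≢v refl)
    TWalk-between-leaves {u} onlyᵤ onlyᵥ (step {t′ = a} _ e _ W) _ v≢x
      with onlyᵤ (TWalk-source∈ W) (_ , e)
    ... | refl = let b , e′ , a<b = TWalk-arrives-from onlyᵥ W (≢-sym v≢x) in
                 a , b , trans (label-sym 𝒢 x u) e , e′ , a<b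

    ClosedTCC⇒¬two-leaves : ClosedTCC 𝒢 S → ∀ {u v} → u ∈ S → v ∈ S → u ≢ v → u ≢ x → v ≢ x →
                            OnlyNeighbour S x u → OnlyNeighbour S x v → ⊥
    ClosedTCC⇒¬two-leaves tcc {u} {v} u∈S v∈S u≢v u≢x v≢x onlyᵤ onlyᵥ
      with TWalk-between-leaves onlyᵤ onlyᵥ (proj₁ (tcc u v u∈S v∈S u≢v)) u≢v v≢x
         | TWalk-between-leaves onlyᵥ onlyᵤ (proj₁ (tcc v u v∈S u∈S (≢-sym u≢v))) (≢-sym u≢v) u≢x
    ... | a , b , eᵤ , eᵥ , a<b | b′ , a′ , eᵥ′ , eᵤ′ , b′<a′
      rewrite just-injective (trans (sym eᵤ) eᵤ′) | just-injective (trans (sym eᵥ) eᵥ′) = <-asym a<b b′<a′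

  module _ {S : Subset n} (minimal : MinimalNontrivialClosedTCC 𝒢 S) {x : Fin n} (x∈S : x ∈ S) where

    private
      tcc : ClosedTCC 𝒢 S
      tcc = proj₂ (proj₁ minimal)

    reachable-or-OnlyNeighbour : ∀ {u v} → u ∈ S - x → v ∈ S - x →
                                 SWalk 𝒢 (S - x) u v ⊎ OnlyNeighbour S x u
    reachable-or-OnlyNeighbour {u} {v} u∈S-x v∈S-x = decide (v ∈? members)
      where
      open Component (component u∈S-x)

      T : Subset n
      T = members ∪ ⁅ x ⁆

      x∉R : x ∉ members
      x∉R x∈R = x∈p-y⇒x≢y (SWalk-target∈ (reachable x∈R)) refl

      T⊆S : T ⊆ S
      T⊆S w∈T with x∈p∪q⁻ members ⁅ x ⁆ w∈T
      ... | inj₁ w∈R    = x∈p-y⇒x∈p (SWalk-target∈ (reachable w∈R))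
      ... | inj₂ w∈⁅x⁆ rewrite x∈⁅y⁆⇒x≡y x w∈⁅x⁆ = x∈S

      T⊂S : v ∉ members → T ⊂ S
      T⊂S v∉R = T⊆S , v , x∈p-y⇒x∈p v∈S-x , v∉T
        where
        v∉T : v ∉ T
        v∉T v∈T with x∈p∪q⁻ members ⁅ x ⁆ v∈T
        ... | inj₁ v∈R    = v∉R v∈R
        ... | inj₂ v∈⁅x⁆ = x∈p-y⇒x≢y v∈S-x (x∈⁅y⁆⇒x≡y x v∈⁅x⁆)

      T-nontrivial : ∀ {z} → z ∈ members → u ≢ z → NontrivialClosedTCC 𝒢 T
      T-nontrivial z∈R u≢z =
        ≤-<-trans (x∈p∧y∈p∧x≢y⇒2≤∣p∣ source∈ z∈R u≢z) (p⊂q⇒∣p∣<∣q∣ (x∉p⇒p⊂p∪⁅x⁆ x∉R)) ,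
        ClosedTCC-restrict (AdjacencyClosed-∪⁅⁆-exits closed) T⊆S tcc

      decide : Dec (v ∈ members) → SWalk 𝒢 (S - x) u v ⊎ OnlyNeighbour S x u
      decide (yes v∈R) = inj₁ (reachable v∈R)
      decide (no v∉R)  = inj₂ λ {z} z∈S uz → decidable-stable (z ≟ x) λ z≢x →
        proj₂ minimal T (T⊂S v∉R)
          (T-nontrivial (closed source∈ (x∈p∧x≢y⇒x∈p-y z∈S z≢x) uz) λ { refl → adjacent-irrefl uz })

    deletion-Connected : Connected 𝒢 (S - x)
    deletion-Connected u v u∈S-x v∈S-x with u ≟ v
    ... | yes refl = done u∈S-x
    ... | no u≢v
      with reachable-or-OnlyNeighbour u∈S-x v∈S-x | reachable-or-OnlyNeighbour v∈S-x u∈S-x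
    ... | inj₁ W     | _          = W
    ... | inj₂ _     | inj₁ W     = SWalk-reverse W
    ... | inj₂ onlyᵤ | inj₂ onlyᵥ = ⊥-elim (ClosedTCC⇒¬two-leaves tcc
          (x∈p-y⇒x∈p u∈S-x) (x∈p-y⇒x∈p v∈S-x) u≢v (x∈p-y⇒x≢y u∈S-x) (x∈p-y⇒x≢y v∈S-x) onlyᵤ onlyᵥ)

lemma19 : ∀ {n : ℕ} (𝒢 : SimpleTemporalGraph n) (S : Subset n) →
          MinimalNontrivialClosedTCC 𝒢 S → TwoVertexConnected 𝒢 S
lemma19 𝒢 S minimal@((3≤∣S∣ , tcc) , _) =
  3≤∣S∣ , ClosedTCC⇒Connected 𝒢 tcc , λ x x∈S → deletion-Connected 𝒢 minimal x∈S
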